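{- Let $v_1$ be a factor of $F(v)$ such that $|v_1|>n_0$. Then $v_1$ comes from a unique factor of $v$, i.e. there is a unique factor $u_1$ of $v$ of length $|v_1|+l$ with $F(u_1)=v_1$.
   Context: Let $\mathcal{A}_2=\{a,b\}$. Let $v$ be an $a$-Sturmian word (a Sturmian word, i.e. with $p_v(n)=n+1$ for all $n$, that contains $a^2$), written in the form $v=a^{l_0}ba^{l+\epsilon_1}ba^{l+\epsilon_2}ba^{l+\epsilon_3}b\cdots$ where $(\epsilon_i)_{i\geq1}$ is a Sturmian sequence over $\{0,1\}$, $l$ is an integer and $l_0\leq l+1$. Let $F$ be the cellular automaton with window length $r=l+1$ defined on words of length $l+1$ by $F(w)=a$ if $w=a^{l+1}$ and $F(w)=b$ otherwise, and extended to words by $F(w)=\varepsilon$ if $|w|<r$ and $F(xyz)=F(xy)F(yz)$ for $x$ a letter, $|y|=r-1$. Let $n_0=k_0(l+1)$, where $k_0$ is the maximum power of $a^{l+\epsilon_i}b$ in $v$. -}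

module Defs where

open import Data.Nat using (ℕ; zero; suc; _+_; _*_; _≤_; _≤?_)
open import Data.Nat.Properties using ()
open import Data.Fin using (Fin; toℕ)
open import Data.Bool using (Bool; true; false; if_then_else_)
open import Data.List using (List; []; _∷_; length; replicate; take; _++_; [_])
open import Data.List.Properties using (≡-dec)
open import Data.List.Relation.Unary.All using (All)
open import Data.List.Relation.Unary.Unique.Propositional using (Unique)
open import Data.List.Membership.Propositional using (_∈_)
open import Data.Product using (Σ; ∃; _×_; _,_)
open import Relation.Binary.PropositionalEquality using (_≡_; refl)
open import Relation.Nullary using (Dec; yes; no)
open import Relation.Nullary.Decidable using (⌊_⌋)

data Letter : Set where
  a b : Letter

_≟L_ : (x y : Letter) → Dec (x ≡ y)
a ≟L a = yes refl
a ≟L b = no λ ()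
b ≟L a = no λ ()
b ≟L b = yes refl

InfWord : Set → Set
InfWord A = ℕ → A

slice : {A : Set} → InfWord A → ℕ → ℕ → List A
slice v i zero = []
slice v i (suc n) = v i ∷ slice v (suc i) n

IsFactor : {A : Set} → InfWord A → List A → Set
IsFactor v w = ∃ λ i → slice v i (length w) ≡ w

-- p_v(n) = m : there are exactly m distinct factors of length n
Complexity : {A : Set} → InfWord A → ℕ → ℕ → Set
Complexity {A} v n m =
  Σ (List (List A)) λ L →
    length L ≡ m × Unique L ×
    All (λ w → length w ≡ n × IsFactor v w) L ×
    (∀ w → length w ≡ n → IsFactor v w → w ∈ L)

Sturmian : {A : Set} → InfWord A → Set
Sturmian v = ∀ n → Complexity v n (suc n)

-- positions of the letter b in a^{l0} b a^{l+ε1} b a^{l+ε2} b ...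
-- (eps i stands for ε_{i+1})
bPos : ℕ → ℕ → (ℕ → Fin 2) → ℕ → ℕ
bPos l0 l eps zero = l0
bPos l0 l eps (suc i) = bPos l0 l eps i + suc (l + toℕ (eps i))

HasForm : InfWord Letter → ℕ → ℕ → (ℕ → Fin 2) → Set
HasForm v l0 l eps =
  (∀ n → v n ≡ b → ∃ λ i → bPos l0 l eps i ≡ n) ×
  (∀ i → v (bPos l0 l eps i) ≡ b)

rule : ℕ → List Letter → Letter
rule l w with ≡-dec _≟L_ w (replicate (suc l) a)
... | yes _ = a
... | no _ = b

Fw : ℕ → List Letter → List Letter
Fw l [] = []
Fw l (x ∷ w) =
  if ⌊ suc l ≤? length (x ∷ w) ⌋
  then rule l (take (suc l) (x ∷ w)) ∷ Fw l w
  else []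

Finf : ℕ → InfWord Letter → InfWord Letter
Finf l v n = rule l (slice v n (suc l))

pow : List Letter → ℕ → List Letter
pow w zero = []
pow w (suc k) = w ++ pow w k

blk : ℕ → Fin 2 → List Letter
blk l e = replicate (l + toℕ e) a ++ [ b ]

IsMaxPower : InfWord Letter → ℕ → (ℕ → Fin 2) → ℕ → Set
IsMaxPower v l eps k0 =
  (∃ λ i → IsFactor v (pow (blk l (eps i)) k0)) ×
  (∀ i k → IsFactor v (pow (blk l (eps i)) k) → k ≤ k0)

{-# OPTIONS --safe #-}
module Submission where

-- F(v) reads an a exactly where v reads a^{l+1}, and the b's of v are at least
-- l + 1 apart.  Hence two preimages of v₁ that agree on one window of length
-- l + 1 stay in agreement letter by letter in both directions as long as their
-- images agree; if v₁ contains an a, the window under it is a^{l+1} in both.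
-- If v₁ = b^m with m > k₀(l + 1), every window of length l + 1 meets a b, which
-- forces b's exactly l + 1 apart: a factor (a^l b)^{k₀+1} of v, against the
-- maximality of k₀.  When such a chain starts inside the initial a^{l₀}, it
-- forces a prefix 0^{k₀} of ε instead, and recurrence of the Sturmian word ε
-- (a non-recurrent prefix would make a suffix right-determined, hence
-- eventually periodic) carries the chain into the interior of v.

open import Defs
open import Data.Nat using (ℕ; zero; suc; _+_; _*_; _∸_; _≤_; _<_; z≤n; s≤s; z<s; s<s; s≤s⁻¹; _<?_; _≤?_)
open import Data.Nat.Properties
open import Data.Nat.Induction using (<-rec)
open import Algebra.Properties.CommutativeSemigroup +-commutativeSemigroup using (xy∙z≈xz∙y)
open import Data.Fin using (Fin; toℕ; fromℕ<) renaming (zero to fzero; suc to fsuc; _<_ to _<ᶠ_; _≟_ to _≟ᶠ_)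
open import Data.Fin.Properties using (pigeonhole; injective⇒≤; fromℕ<-injective)
open import Data.List using (List; []; _∷_; length; replicate; take; _++_; [_]; lookup)
open import Data.List.Properties using (≡-dec; ∷-injectiveˡ; ∷-injectiveʳ; length-++; length-replicate)
open import Data.List.Relation.Unary.All as All using (All; _∷_)
open import Data.List.Relation.Unary.AllPairs using (_∷_)
open import Data.List.Relation.Unary.Any using (here; there; index)
open import Data.List.Relation.Unary.Any.Properties using (lookup-index)
open import Data.List.Relation.Unary.Unique.Propositional using (Unique)
open import Data.List.Membership.Propositional using (_∈_)
open import Data.List.Membership.Propositional.Properties using (∈-lookup)
open import Data.List.Membership.DecPropositional _≟L_ using (_∈?_)
open import Data.Product using (∃; ∃₂; ∃!; _×_; _,_; proj₁; proj₂)
open import Data.Sum using (inj₁; inj₂)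
open import Function using (_∘_)
open import Data.Empty using (⊥; ⊥-elim)
open import Relation.Binary.Definitions using (DecidableEquality)
open import Relation.Binary.PropositionalEquality hiding ([_])
open import Relation.Nullary using (yes; no; ¬_; contradiction)

-- Windows of infinite words

module _ {A : Set} where

  length-slice : (x : InfWord A) (p n : ℕ) → length (slice x p n) ≡ n
  length-slice x p zero    = refl
  length-slice x p (suc n) = cong suc (length-slice x (suc p) n)

  slice-isFactor : (x : InfWord A) (p n : ℕ) → IsFactor x (slice x p n)
  slice-isFactor x p n = p , cong (slice x p) (length-slice x p n)

  slice-cong : {x y : InfWord A} (p q n : ℕ) →
    (∀ t → t < n → x (p + t) ≡ y (q + t)) → slice x p n ≡ slice y q n
  slice-cong         p q zero    _  = refl
  slice-cong {x} {y} p q (suc n) eq = cong₂ _∷_ head-eq (slice-cong (suc p) (suc q) n tail-eq)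
    where
    head-eq : x p ≡ y q
    head-eq = subst₂ (λ i j → x i ≡ y j) (+-identityʳ p) (+-identityʳ q) (eq 0 z<s)
    tail-eq : ∀ t → t < n → x (suc p + t) ≡ y (suc q + t)
    tail-eq t t<n = subst₂ (λ i j → x i ≡ y j) (+-suc p t) (+-suc q t) (eq (suc t) (s<s t<n))

  slice-≡⇒pointwise : {x y : InfWord A} (p q n : ℕ) →
    slice x p n ≡ slice y q n → ∀ t → t < n → x (p + t) ≡ y (q + t)
  slice-≡⇒pointwise {x} {y} p q (suc n) eq zero    _         =
    subst₂ (λ i j → x i ≡ y j) (sym (+-identityʳ p)) (sym (+-identityʳ q)) (∷-injectiveˡ eq)
  slice-≡⇒pointwise {x} {y} p q (suc n) eq (suc t) (s<s t<n) =
    subst₂ (λ i j → x i ≡ y j) (sym (+-suc p t)) (sym (+-suc q t))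
      (slice-≡⇒pointwise (suc p) (suc q) n (∷-injectiveʳ eq) t t<n)

  slice-prefix : {x y : InfWord A} {p q n : ℕ} (k : ℕ) → k ≤ n →
    slice x p n ≡ slice y q n → slice x p k ≡ slice y q k
  slice-prefix {p = p} {q} k k≤n eq =
    slice-cong p q k λ t t<k → slice-≡⇒pointwise p q _ eq t (<-≤-trans t<k k≤n)

  slice-extend : {x y : InfWord A} {p q n : ℕ} →
    slice x p n ≡ slice y q n → x (p + n) ≡ y (q + n) → slice x p (suc n) ≡ slice y q (suc n)
  slice-extend {x} {y} {p} {q} {n} eq last = slice-cong p q (suc n) agree
    where
    agree : ∀ t → t < suc n → x (p + t) ≡ y (q + t)
    agree t t<1+n with m≤n⇒m<n∨m≡n (s≤s⁻¹ t<1+n)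
    ... | inj₁ t<n  = slice-≡⇒pointwise p q n eq t t<n
    ... | inj₂ refl = last

  take-slice : (x : InfWord A) (p k n : ℕ) → k ≤ n → take k (slice x p n) ≡ slice x p k
  take-slice x p zero    n       _         = refl
  take-slice x p (suc k) (suc n) (s≤s k≤n) = cong (x p ∷_) (take-slice x (suc p) k n k≤n)

  windows⇒slice : {x y : InfWord A} {n : ℕ} (p k : ℕ) →
    (∀ j → j ≤ k → slice x (p + j) (suc n) ≡ slice y (p + j) (suc n)) →
    slice x p (k + suc n) ≡ slice y p (k + suc n)
  windows⇒slice {x} {y} {n} p zero    windows =
    subst (λ i → slice x i (suc n) ≡ slice y i (suc n)) (+-identityʳ p) (windows 0 z≤n)
  windows⇒slice {x} {y} {n} p (suc k) windows = cong₂ _∷_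
    (∷-injectiveˡ (windows⇒slice p 0 λ j j≤0 → windows j (≤-trans j≤0 z≤n)))
    (windows⇒slice (suc p) k λ j j≤k →
      subst (λ i → slice x i (suc n) ≡ slice y i (suc n)) (+-suc p j) (windows (suc j) (s≤s j≤k)))

  slice-++ : (x : InfWord A) (p m n : ℕ) → slice x p (m + n) ≡ slice x p m ++ slice x (p + m) n
  slice-++ x p zero    n = cong (λ i → slice x i n) (sym (+-identityʳ p))
  slice-++ x p (suc m) n = cong (x p ∷_)
    (trans (slice-++ x (suc p) m n) (cong (λ i → slice x (suc p) m ++ slice x i n) (sym (+-suc p m))))

  slice-shift : (x : InfWord A) (k p n : ℕ) → slice (λ t → x (k + t)) p n ≡ slice x (k + p) n
  slice-shift x k p n = slice-cong p (k + p) n λ t _ → cong x (sym (+-assoc k p t))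

  slice-∈ : (x : InfWord A) (p n t : ℕ) → t < n → x (p + t) ∈ slice x p n
  slice-∈ x p (suc n) zero    _         = here (cong x (+-identityʳ p))
  slice-∈ x p (suc n) (suc t) (s<s t<n) =
    there (subst (_∈ slice x (suc p) n) (cong x (sym (+-suc p t))) (slice-∈ x (suc p) n t t<n))

  ∈-slice⁻ : {x : InfWord A} {y : A} (p n : ℕ) → y ∈ slice x p n → ∃ λ t → t < n × x (p + t) ≡ y
  ∈-slice⁻ {x} p (suc n) (here y≡) = 0 , z<s , trans (cong x (+-identityʳ p)) (sym y≡)
  ∈-slice⁻ {x} p (suc n) (there y∈) with ∈-slice⁻ (suc p) n y∈
  ... | t , t<n , xt = suc t , s<s t<n , trans (cong x (+-suc p t)) xt

  factor-slice : {x : InfWord A} {n : ℕ} {w : List A} → length w ≡ n → IsFactor x w →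
    ∃ λ p → slice x p n ≡ w
  factor-slice refl f = f

  slice-const : (c : A) (p n : ℕ) → slice (λ _ → c) p n ≡ replicate n c
  slice-const c p zero    = refl
  slice-const c p (suc n) = cong (c ∷_) (slice-const c (suc p) n)

-- Counting factors

lookup-injective : {A : Set} {xs : List A} → Unique xs → ∀ i j → lookup xs i ≡ lookup xs j → i ≡ j
lookup-injective (_  ∷ _) fzero    fzero    _  = refl
lookup-injective (x∉ ∷ _) fzero    (fsuc j) eq = contradiction eq (All.lookup x∉ (∈-lookup j))
lookup-injective (x∉ ∷ _) (fsuc i) fzero    eq = contradiction (sym eq) (All.lookup x∉ (∈-lookup i))
lookup-injective (_  ∷ u) (fsuc i) (fsuc j) eq = cong fsuc (lookup-injective u i j eq)

module _ {A : Set} where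

  windows-collide : {x : InfWord A} {n m k : ℕ} → Complexity x n m → m < k → (pos : Fin k → ℕ) →
    ∃₂ λ i j → i <ᶠ j × slice x (pos i) n ≡ slice x (pos j) n
  windows-collide {x} {n} (L , refl , _ , _ , complete) m<k pos = collide (pigeonhole m<k (index ∘ window∈L))
    where
    window∈L : ∀ i → slice x (pos i) n ∈ L
    window∈L i = complete _ (length-slice x (pos i) n) (slice-isFactor x (pos i) n)
    collide : (∃₂ λ i j → i <ᶠ j × index (window∈L i) ≡ index (window∈L j)) →
      ∃₂ λ i j → i <ᶠ j × slice x (pos i) n ≡ slice x (pos j) n
    collide (i , j , i<j , same) =
      i , j , i<j , trans (lookup-index (window∈L i)) (trans (cong (lookup L) same) (sym (lookup-index (window∈L j))))

  complexity-≤ : {x : InfWord A} {n m k : ℕ} → Complexity x n m →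
    (∀ p → ∃ λ q → q < k × slice x p n ≡ slice x q n) → m ≤ k
  complexity-≤ {x} {n} {k = k} (L , refl , unique , factors , _) canonical = injective⇒≤ position-injective
    where
    occurrence : (i : Fin (length L)) → ∃ λ q → q < k × slice x q n ≡ lookup L i
    occurrence i with All.lookup factors (∈-lookup i)
    ... | refl , p , eq with canonical p
    ...   | q , q<k , eq′ = q , q<k , trans (sym eq′) eq
    position : Fin (length L) → Fin k
    position i = fromℕ< (proj₁ (proj₂ (occurrence i)))
    position-injective : ∀ {i j} → position i ≡ position j → i ≡ j
    position-injective {i} {j} eq = lookup-injective unique i j (begin
      lookup L i                          ≡⟨ sym (proj₂ (proj₂ (occurrence i))) ⟩
      slice x (proj₁ (occurrence i)) n    ≡⟨ cong (λ q → slice x q n) (fromℕ<-injective _ _ _ _ eq) ⟩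
      slice x (proj₁ (occurrence j)) n    ≡⟨ proj₂ (proj₂ (occurrence j)) ⟩
      lookup L j                          ∎)
      where open ≡-Reasoning

-- Sturmian words are aperiodic and recurrent

module _ {A : Set} {x : InfWord A} where

  right-determined⇒periodic : {n c d : ℕ} →
    (∀ u → slice x (c + u) n ≡ slice x (d + u) n → x (c + u + n) ≡ x (d + u + n)) →
    slice x c n ≡ slice x d n → ∀ u → x (c + u) ≡ x (d + u)
  right-determined⇒periodic {n} {c} {d} determined eq u = ∷-injectiveˡ (extended u)
    where
    windows : ∀ u → slice x (c + u) n ≡ slice x (d + u) n
    extended : ∀ u → slice x (c + u) (suc n) ≡ slice x (d + u) (suc n)
    extended u = slice-extend (windows u) (determined u (windows u))
    windows zero    = subst₂ (λ i j → slice x i n ≡ slice x j n) (sym (+-identityʳ c)) (sym (+-identityʳ d)) eq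
    windows (suc u) = subst₂ (λ i j → slice x i n ≡ slice x j n) (sym (+-suc c u)) (sym (+-suc d u))
      (∷-injectiveʳ (extended u))

  eventually-periodic⇒complexity-≤ : {c d N m : ℕ} → c < d → (∀ u → x (c + u) ≡ x (d + u)) →
    Complexity x N m → m ≤ d
  eventually-periodic⇒complexity-≤ {c} {d} {N} c<d periodic cx = complexity-≤ cx (<-rec _ canonical)
    where
    canonical : ∀ p → (∀ {p′} → p′ < p → ∃ λ q → q < d × slice x p′ N ≡ slice x q N) →
      ∃ λ q → q < d × slice x p N ≡ slice x q N
    canonical p rec with p <? d
    ... | yes p<d = p , p<d , refl
    ... | no p≮d with m≤n⇒∃[o]m+o≡n (≮⇒≥ p≮d)
    ...   | w , refl with rec (+-monoˡ-< w c<d)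
    ...     | q , q<d , eq = q , q<d , trans (slice-cong (d + w) (c + w) N shifted) eq
      where
      shifted : ∀ t → t < N → x (d + w + t) ≡ x (c + w + t)
      shifted t _ = begin
        x (d + w + t)   ≡⟨ cong x (+-assoc d w t) ⟩
        x (d + (w + t)) ≡⟨ sym (periodic (w + t)) ⟩
        x (c + (w + t)) ≡⟨ cong x (sym (+-assoc c w t)) ⟩
        x (c + w + t)   ∎
        where open ≡-Reasoning

  sturmian-aperiodic : Sturmian x → {c d : ℕ} → c < d → ¬ (∀ u → x (c + u) ≡ x (d + u))
  sturmian-aperiodic sturmian {d = d} c<d periodic = 1+n≰n (eventually-periodic⇒complexity-≤ c<d periodic (sturmian d))

module _ {A : Set} (_≟_ : DecidableEquality A) {x : InfWord A} (sturmian : Sturmian x) where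

  private
    module PrefixStep (n j : ℕ) (recurs : slice x (suc j) n ≡ slice x 0 n)
                      (isolated : ∀ j → slice x (suc j) (suc n) ≢ slice x 0 (suc n))
                      {Ln : List (List A)} (length-Ln : length Ln ≡ suc n) (unique-Ln : Unique Ln)
                      (factors-Ln : All (λ w → length w ≡ n × IsFactor x w) Ln)
                      (complete-Ln : ∀ w → length w ≡ n → IsFactor x w → w ∈ Ln) where

      window∈Ln : ∀ p → slice x p n ∈ Ln
      window∈Ln p = complete-Ln _ (length-slice x p n) (slice-isFactor x p n)

      late-occurrence : (r : Fin (length Ln)) → ∃ λ q → slice x (suc q) n ≡ lookup Ln r
      late-occurrence r with All.lookup factors-Ln (∈-lookup r)
      ... | len , f with factor-slice len f
      ...   | zero  , eq = j , trans recurs eq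
      ...   | suc p , eq = p , eq

      occ : Fin (length Ln) → ℕ
      occ r = proj₁ (late-occurrence r)

      occ-window : ∀ r → slice x (suc (occ r)) n ≡ lookup Ln r
      occ-window r = proj₂ (late-occurrence r)

      -- Otherwise the two extensions of this window, late occurrences of the
      -- other n-factors and the isolated prefix are n + 3 distinct factors of
      -- length n + 1.
      suffix-right-determined : ∀ p q → slice x (suc p) n ≡ slice x (suc q) n → x (suc p + n) ≡ x (suc q + n)
      suffix-right-determined p q same with x (suc p + n) ≟ x (suc q + n)
      ... | yes agree = agree
      ... | no differ = ⊥-elim (distinct (windows-collide (sturmian (suc n)) more-positions pos))
        where
        r₀ : Fin (length Ln)
        r₀ = index (window∈Ln (suc p))

        window-r₀ : slice x (suc p) n ≡ lookup Ln r₀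
        window-r₀ = lookup-index (window∈Ln (suc p))

        branch : ∃ λ e → slice x (suc e) n ≡ lookup Ln r₀ ×
                         slice x (suc e) (suc n) ≢ slice x (suc (occ r₀)) (suc n)
        branch with ≡-dec _≟_ (slice x (suc p) (suc n)) (slice x (suc (occ r₀)) (suc n))
        ... | no  p≢occ  = p , window-r₀ , p≢occ
        ... | yes p≡occ  = q , trans (sym same) window-r₀ , λ q≡occ →
          differ (slice-≡⇒pointwise (suc p) (suc q) (suc n) (trans p≡occ (sym q≡occ)) n ≤-refl)

        late : Fin (suc (length Ln)) → ℕ
        late fzero    = proj₁ branch
        late (fsuc r) = occ r

        pos : Fin (suc (suc (length Ln))) → ℕ
        pos fzero    = 0
        pos (fsuc k) = suc (late k)

        more-positions : suc (suc n) < suc (suc (length Ln))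
        more-positions = subst (λ k → suc (suc n) < suc (suc k)) (sym length-Ln) ≤-refl

        prefix-eq : ∀ {i j} → slice x (suc i) (suc n) ≡ slice x (suc j) (suc n) →
          slice x (suc i) n ≡ slice x (suc j) n
        prefix-eq = slice-prefix n (n≤1+n n)

        distinct : (∃₂ λ i j → i <ᶠ j × slice x (pos i) (suc n) ≡ slice x (pos j) (suc n)) → ⊥
        distinct (fzero , fsuc k , _ , eq) = isolated (late k) (sym eq)
        distinct (fsuc fzero , fsuc fzero , s≤s () , _)
        distinct (fsuc fzero , fsuc (fsuc r) , _ , eq) =
          proj₂ (proj₂ branch) (subst (λ r → slice x _ (suc n) ≡ slice x (suc (occ r)) (suc n)) (sym r₀≡r) eq)
          where
          r₀≡r : r₀ ≡ r
          r₀≡r = lookup-injective unique-Ln r₀ r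
            (trans (sym (proj₁ (proj₂ branch))) (trans (prefix-eq eq) (occ-window r)))
        distinct (fsuc (fsuc r) , fsuc (fsuc r′) , s≤s (s≤s r<r′) , eq) = <-irrefl
          (cong toℕ (lookup-injective unique-Ln r r′
            (trans (sym (occ-window r)) (trans (prefix-eq eq) (occ-window r′)))))
          r<r′

      isolated-prefix-absurd : ⊥
      isolated-prefix-absurd with windows-collide (sturmian n) ≤-refl (λ (i : Fin (suc (suc n))) → suc (toℕ i))
      ... | i , i′ , i<i′ , eq = sturmian-aperiodic sturmian (s<s i<i′)
        (right-determined⇒periodic (λ u → suffix-right-determined (toℕ i + u) (toℕ i′ + u)) eq)

  ¬¬-prefix-recurs : ∀ K → ¬ (∀ j → slice x (suc j) K ≢ slice x 0 K)
  ¬¬-prefix-recurs zero    never = never 0 refl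
  ¬¬-prefix-recurs (suc n) never with sturmian n
  ... | _ , length-Ln , unique-Ln , factors-Ln , complete-Ln = ¬¬-prefix-recurs n λ j recurs →
    PrefixStep.isolated-prefix-absurd n j recurs never length-Ln unique-Ln factors-Ln complete-Ln

other-letter : ∀ {c d e : Fin 2} → c ≢ d → c ≢ e → d ≡ e
other-letter {fzero}      {fzero}      c≢d _   = contradiction refl c≢d
other-letter {fzero}      {fsuc fzero} {fzero}      _ c≢e = contradiction refl c≢e
other-letter {fzero}      {fsuc fzero} {fsuc fzero} _ _   = refl
other-letter {fsuc fzero} {fzero}      {fzero}      _ _   = refl
other-letter {fsuc fzero} {fzero}      {fsuc fzero} _ c≢e = contradiction refl c≢e
other-letter {fsuc fzero} {fsuc fzero} c≢d _   = contradiction refl c≢d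

sturmian-binary-letter : {x : InfWord (Fin 2)} → Sturmian x → (c : Fin 2) → ∃ λ j → x j ≡ c
sturmian-binary-letter {x} sturmian c with sturmian 1
... | w₁ ∷ w₂ ∷ [] , refl , (w₁≢w₂ ∷ _) ∷ _ , (len₁ , f₁) ∷ (len₂ , f₂) ∷ _ , _
  with factor-slice len₁ f₁ | factor-slice len₂ f₂
...   | p₁ , refl | p₂ , refl with x p₁ ≟ᶠ c
...     | yes x₁≡c = p₁ , x₁≡c
...     | no  x₁≢c = p₂ , other-letter (λ eq → w₁≢w₂ (cong (_∷ []) eq)) x₁≢c

-- The cellular automaton F

≢b⇒≡a : ∀ {c} → c ≢ b → c ≡ a
≢b⇒≡a {a} _   = refl
≢b⇒≡a {b} c≢b = contradiction refl c≢b

≢a⇒≡b : ∀ {c} → c ≢ a → c ≡ b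
≢a⇒≡b {a} c≢a = contradiction refl c≢a
≢a⇒≡b {b} _   = refl

agree-unless-conflict : ∀ {c d} → (c ≡ a → d ≡ b → ⊥) → (d ≡ a → c ≡ b → ⊥) → c ≡ d
agree-unless-conflict {a} {a} _ _ = refl
agree-unless-conflict {a} {b} conflict _ = ⊥-elim (conflict refl refl)
agree-unless-conflict {b} {a} _ conflict = ⊥-elim (conflict refl refl)
agree-unless-conflict {b} {b} _ _ = refl

b∈-unless-replicate : ∀ w → w ≢ replicate (length w) a → b ∈ w
b∈-unless-replicate []      w≢ = contradiction refl w≢
b∈-unless-replicate (a ∷ w) w≢ = there (b∈-unless-replicate w (w≢ ∘ cong (a ∷_)))
b∈-unless-replicate (b ∷ w) _  = here refl

module _ (l : ℕ) (x : InfWord Letter) where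

  Finf-a⇒window : ∀ {p} → Finf l x p ≡ a → slice x p (suc l) ≡ replicate (suc l) a
  Finf-a⇒window {p} eq with ≡-dec _≟L_ (slice x p (suc l)) (replicate (suc l) a)
  ... | yes window = window

  window⇒Finf-a : ∀ {p} → (∀ s → s < suc l → x (p + s) ≡ a) → Finf l x p ≡ a
  window⇒Finf-a {p} all-a with ≡-dec _≟L_ (slice x p (suc l)) (replicate (suc l) a)
  ... | yes _ = refl
  ... | no not-all-a = contradiction (trans (slice-cong p 0 (suc l) all-a) (slice-const a 0 (suc l))) not-all-a

  Finf-a⇒a : ∀ {p} → Finf l x p ≡ a → ∀ s → s < suc l → x (p + s) ≡ a
  Finf-a⇒a {p} eq = slice-≡⇒pointwise p 0 (suc l) (trans (Finf-a⇒window eq) (sym (slice-const a 0 (suc l))))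

  Finf-b⇒b : ∀ {p} → Finf l x p ≡ b → ∃ λ s → s < suc l × x (p + s) ≡ b
  Finf-b⇒b {p} eq with ≡-dec _≟L_ (slice x p (suc l)) (replicate (suc l) a)
  ... | no not-all-a = ∈-slice⁻ p (suc l)
    (b∈-unless-replicate _
      (subst (λ n → slice x p (suc l) ≢ replicate n a) (sym (length-slice x p (suc l))) not-all-a))

  Finf-shift : ∀ k p → Finf l (λ t → x (k + t)) p ≡ Finf l x (k + p)
  Finf-shift k p = cong (rule l) (slice-shift x k p (suc l))

Fw-short : ∀ l w → length w < suc l → Fw l w ≡ []
Fw-short l []      _   = refl
Fw-short l (x ∷ w) lt with suc l ≤? length (x ∷ w)
... | yes le = contradiction (<-≤-trans lt le) (<-irrefl refl)
... | no  _  = refl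

Fw-slice : ∀ l (v : InfWord Letter) i n → Fw l (slice v i (n + l)) ≡ slice (Finf l v) i n
Fw-slice l v i zero = Fw-short l (slice v i l) (subst (_< suc l) (sym (length-slice v i l)) ≤-refl)
Fw-slice l v i (suc n) with suc l ≤? length (slice v i (suc n + l))
... | no  short = contradiction (subst (suc l ≤_) (sym (length-slice v i (suc n + l))) (s≤s (m≤n+m l n))) short
... | yes _     = cong₂ _∷_ (cong (rule l) (take-slice v i (suc l) (suc (n + l)) (s≤s (m≤n+m l n))))
                            (Fw-slice l v (suc i) n)

-- Words in which consecutive b's are at least l + 1 apart

m+n*o+o≡m+[1+n]*o : ∀ m n o → m + n * o + o ≡ m + suc n * o
m+n*o+o≡m+[1+n]*o m n o = trans (+-assoc m (n * o) o) (cong (m +_) (+-comm (n * o) o))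

slice-pow : (x : InfWord Letter) (r n : ℕ) (w : List Letter) →
  (∀ t → t < n → slice x (r + t * length w) (length w) ≡ w) →
  slice x r (length (pow w n)) ≡ pow w n
slice-pow x r zero    w _      = refl
slice-pow x r (suc n) w blocks = begin
  slice x r (length (w ++ pow w n))                              ≡⟨ cong (slice x r) (length-++ w) ⟩
  slice x r (length w + length (pow w n))                         ≡⟨ slice-++ x r (length w) (length (pow w n)) ⟩
  slice x r (length w) ++ slice x (r + length w) (length (pow w n)) ≡⟨ cong₂ _++_ first rest ⟩
  w ++ pow w n                                                    ∎
  where
  open ≡-Reasoning
  first : slice x r (length w) ≡ w
  first = trans (cong (λ i → slice x i (length w)) (sym (+-identityʳ r))) (blocks 0 z<s)
  rest : slice x (r + length w) (length (pow w n)) ≡ pow w n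
  rest = slice-pow x (r + length w) n w λ t t<n →
    trans (cong (λ i → slice x i (length w)) (+-assoc r (length w) (t * length w))) (blocks (suc t) (s<s t<n))

BSpaced : ℕ → InfWord Letter → Set
BSpaced l x = ∀ {p d} → x p ≡ b → x (p + suc d) ≡ b → l ≤ d

module _ {l : ℕ} {x : InfWord Letter} (spaced : BSpaced l x) where

  a-after-b : ∀ {p s} → x p ≡ b → s < l → x (p + suc s) ≡ a
  a-after-b xp s<l = ≢b⇒≡a λ xb → <⇒≱ s<l (spaced xp xb)

  a-before-b : ∀ {p s} → x (p + l) ≡ b → s < l → x (p + s) ≡ a
  a-before-b {p} {s} xb s<l with m≤n⇒∃[o]m+o≡n s<l
  ... | o , refl = ≢b⇒≡a λ xa → <⇒≱ (m<n+m o z<s) (spaced xa (subst (λ i → x i ≡ b) distance xb))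
    where
    distance : p + (suc s + o) ≡ p + s + suc o
    distance = trans (cong (p +_) (sym (+-suc s o))) (sym (+-assoc p s (suc o)))

  BSpaced-shift : ∀ k → BSpaced l (λ t → x (k + t))
  BSpaced-shift k {p} {d} xp xq = spaced xp (subst (λ i → x i ≡ b) (sym (+-assoc k p (suc d))) xq)

  -- The b in the window just after a b can only sit l + 1 past it.
  b-chain : ∀ {q K} → x q ≡ b → (∀ t → t < K → Finf l x (suc q + t * suc l) ≡ b) →
    ∀ t → t ≤ K → x (q + t * suc l) ≡ b
  b-chain {q} xq _   zero    _        = trans (cong x (+-identityʳ q)) xq
  b-chain {q} xq F-b (suc t) t<K with Finf-b⇒b l x (F-b t t<K)
  ... | s , s<1+l , xb = subst (λ i → x i ≡ b) next
    (subst (λ s → x (p + suc s) ≡ b) (≤-antisym (s≤s⁻¹ s<1+l) (spaced previous xb′)) xb′)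
    where
    p = q + t * suc l
    previous : x p ≡ b
    previous = b-chain xq F-b t (<⇒≤ t<K)
    xb′ : x (p + suc s) ≡ b
    xb′ = trans (cong x (+-suc p s)) xb
    next : p + suc l ≡ q + suc t * suc l
    next = m+n*o+o≡m+[1+n]*o q t (suc l)

  block-at : ∀ {q} → x (q + l) ≡ b → slice x q (length (blk l fzero)) ≡ blk l fzero
  block-at {q} xb = begin
    slice x q (length (blk l fzero))                 ≡⟨ cong (slice x q) (length-++ (replicate (l + 0) a)) ⟩
    slice x q (length (replicate (l + 0) a) + 1)     ≡⟨ cong (λ n → slice x q (n + 1)) (length-replicate (l + 0)) ⟩
    slice x q (l + 0 + 1)                            ≡⟨ slice-++ x q (l + 0) 1 ⟩
    slice x q (l + 0) ++ slice x (q + (l + 0)) 1     ≡⟨ cong₂ _++_ a-block b-end ⟩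
    replicate (l + 0) a ++ [ b ]                     ∎
    where
    open ≡-Reasoning
    a-block : slice x q (l + 0) ≡ replicate (l + 0) a
    a-block = trans (slice-cong q 0 (l + 0) λ s s<l → a-before-b xb (subst (s <_) (+-identityʳ l) s<l))
                    (slice-const a 0 (l + 0))
    b-end : slice x (q + (l + 0)) 1 ≡ [ b ]
    b-end = cong [_] (trans (cong (λ n → x (q + n)) (+-identityʳ l)) xb)

  block-power : ∀ {r K} → (∀ t → t ≤ K → x (r + l + t * suc l) ≡ b) → IsFactor x (pow (blk l fzero) (suc K))
  block-power {r} {K} chain = r , slice-pow x r (suc K) (blk l fzero) λ t t<1+K →
    subst (λ n → slice x (r + t * n) (length (blk l fzero)) ≡ blk l fzero) (sym length-blk₀)
      (block-at (subst (λ i → x i ≡ b) (xy∙z≈xz∙y r l (t * suc l)) (chain t (s≤s⁻¹ t<1+K))))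
    where
    length-blk₀ : length (blk l fzero) ≡ suc l
    length-blk₀ = trans (length-++ (replicate (l + 0) a)) (trans (cong (_+ 1) (length-replicate (l + 0)))
      (trans (+-comm (l + 0) 1) (cong suc (+-identityʳ l))))

SameWindow : ℕ → InfWord Letter → InfWord Letter → ℕ → Set
SameWindow l x y p = slice x p (suc l) ≡ slice y p (suc l)

-- Were x and y to differ just past a common window, the l a's next to the b
-- of y would be copied into x, so F would read a on x and b on y there.
module _ {l : ℕ} {x y : InfWord Letter} where

  forward-conflict : BSpaced l y → ∀ {p} → SameWindow l x y p → Finf l x (suc p) ≡ Finf l y (suc p) →
    x (p + suc l) ≡ a → y (p + suc l) ≡ b → ⊥
  forward-conflict y-spaced {p} window F-eq xa yb =
    contradiction (trans (sym (Finf-a⇒a l y (trans (sym F-eq) (window⇒Finf-a l x x-all-a)) l ≤-refl)) yb') λ ()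
    where
    yb' : y (suc p + l) ≡ b
    yb' = trans (cong y (sym (+-suc p l))) yb
    x-all-a : ∀ s → s < suc l → x (suc p + s) ≡ a
    x-all-a s s<1+l with m≤n⇒m<n∨m≡n (s≤s⁻¹ s<1+l)
    ... | inj₂ refl = trans (cong x (sym (+-suc p s))) xa
    ... | inj₁ s<l  = begin
      x (suc p + s)  ≡⟨ cong x (+-suc p s) ⟨
      x (p + suc s)  ≡⟨ slice-≡⇒pointwise p p (suc l) window (suc s) (s<s s<l) ⟩
      y (p + suc s)  ≡⟨ cong y (+-suc p s) ⟩
      y (suc p + s)  ≡⟨ a-before-b {x = y} y-spaced {suc p} yb' s<l ⟩
      a              ∎
      where open ≡-Reasoning

  backward-conflict : BSpaced l y → ∀ {p} → SameWindow l x y (suc p) → Finf l x p ≡ Finf l y p →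
    x p ≡ a → y p ≡ b → ⊥
  backward-conflict y-spaced {p} window F-eq xa yb =
    contradiction (trans (sym (Finf-a⇒a l y (trans (sym F-eq) (window⇒Finf-a l x x-all-a)) 0 z<s)) yb') λ ()
    where
    yb' : y (p + 0) ≡ b
    yb' = trans (cong y (+-identityʳ p)) yb
    x-all-a : ∀ s → s < suc l → x (p + s) ≡ a
    x-all-a zero    _           = trans (cong x (+-identityʳ p)) xa
    x-all-a (suc s) (s<s s<l) = begin
      x (p + suc s)  ≡⟨ cong x (+-suc p s) ⟩
      x (suc p + s)  ≡⟨ slice-≡⇒pointwise (suc p) (suc p) (suc l) window s (m<n⇒m<1+n s<l) ⟩
      y (suc p + s)  ≡⟨ cong y (+-suc p s) ⟨
      y (p + suc s)  ≡⟨ a-after-b {x = y} y-spaced yb s<l ⟩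
      a              ∎
      where open ≡-Reasoning

module _ {l : ℕ} {x y : InfWord Letter} (x-spaced : BSpaced l x) (y-spaced : BSpaced l y) where

  window-forward : ∀ {p} → SameWindow l x y p → Finf l x (suc p) ≡ Finf l y (suc p) → SameWindow l x y (suc p)
  window-forward window F-eq = ∷-injectiveʳ (slice-extend window (agree-unless-conflict
    (forward-conflict y-spaced window F-eq)
    (forward-conflict x-spaced (sym window) (sym F-eq))))

  window-backward : ∀ {p} → SameWindow l x y (suc p) → Finf l x p ≡ Finf l y p → SameWindow l x y p
  window-backward window F-eq = cong₂ _∷_
    (agree-unless-conflict (backward-conflict y-spaced window F-eq) (backward-conflict x-spaced (sym window) (sym F-eq)))
    (slice-prefix l (n≤1+n l) window)

  windows-from : ∀ {m t₀} → (∀ t → t < m → Finf l x t ≡ Finf l y t) → t₀ < m → SameWindow l x y t₀ →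
    ∀ p → p < m → SameWindow l x y p
  windows-from {m} {t₀} F-eq t₀<m window-t₀ p p<m = up p p<m (down t₀ t₀<m window-t₀)
    where
    down : ∀ q → q < m → SameWindow l x y q → SameWindow l x y 0
    down zero    _   window = window
    down (suc q) q<m window = down q (<-trans (n<1+n q) q<m) (window-backward window (F-eq q (<-trans (n<1+n q) q<m)))
    up : ∀ p → p < m → SameWindow l x y 0 → SameWindow l x y p
    up zero    _   window = window
    up (suc p) p<m window = window-forward (up p (<-trans (n<1+n p) p<m) window) (F-eq (suc p) p<m)

  slice-determined-by-Finf : ∀ {m t₀} → (∀ t → t < m → Finf l x t ≡ Finf l y t) →
    t₀ < m → Finf l x t₀ ≡ a →
    slice x 0 (m + l) ≡ slice y 0 (m + l)
  slice-determined-by-Finf {suc k} {t₀} F-eq t₀<m F-a = subst (λ n → slice x 0 n ≡ slice y 0 n) (+-suc k l)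
    (windows⇒slice 0 k λ j j≤k → windows-from F-eq t₀<m window-t₀ j (s≤s j≤k))
    where
    window-t₀ : SameWindow l x y t₀
    window-t₀ = trans (Finf-a⇒window l x F-a) (sym (Finf-a⇒window l y (trans (sym (F-eq t₀ t₀<m)) F-a)))

-- The words a^{l₀} b a^{l+ε₁} b a^{l+ε₂} b ⋯

module Form {v : InfWord Letter} {l₀ l : ℕ} {eps : ℕ → Fin 2} (form : HasForm v l₀ l eps) where

  private
    bp : ℕ → ℕ
    bp = bPos l₀ l eps

  bPos-step : ∀ j → bp j + suc l ≤ bp (suc j)
  bPos-step j = +-monoʳ-≤ (bp j) (s≤s (m≤m+n l (toℕ (eps j))))

  bPos-mono : ∀ {j j′} → j ≤ j′ → bp j ≤ bp j′
  bPos-mono {j′ = zero}   z≤n = ≤-refl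
  bPos-mono {j′ = suc j′} j≤1+j′ with m≤n⇒m<n∨m≡n j≤1+j′
  ... | inj₂ refl       = ≤-refl
  ... | inj₁ (s≤s j≤j′) = ≤-trans (bPos-mono j≤j′) (m≤m+n (bp j′) _)

  no-b-between : ∀ {j q} → bp j < q → q < bp (suc j) → v q ≢ b
  no-b-between {j} bp<q q<bp vq with proj₁ form _ vq
  ... | j′ , refl with j′ ≤? j
  ...   | yes j′≤j = <⇒≱ bp<q (bPos-mono j′≤j)
  ...   | no  j′≰j = <⇒≱ q<bp (bPos-mono (≰⇒> j′≰j))

  b-spaced : BSpaced l v
  b-spaced {p} {d} vp vq with proj₁ form p vp | l ≤? d
  ... | _ , _    | yes l≤d = l≤d
  ... | j , refl | no  l≰d = contradiction vq (no-b-between {j} (m<m+n (bp j) z<s)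
        (<-≤-trans (+-monoʳ-< (bp j) (s≤s (≰⇒> l≰d))) (bPos-step j)))

  consecutive-b⇒ε₀ : ∀ j → v (bp j + suc l) ≡ b → eps j ≡ fzero
  consecutive-b⇒ε₀ j vb with eps j in eq
  ... | fzero      = refl
  ... | fsuc fzero = contradiction vb (no-b-between {j} (m<m+n (bp j) z<s) between)
    where
    between : bp j + suc l < bp (suc j)
    between = subst (λ e → bp j + suc l < bp j + suc (l + toℕ e)) (sym eq)
      (+-monoʳ-< (bp j) (s<s (subst (l <_) (sym (+-comm l 1)) ≤-refl)))

  first-b : ∀ {q} → v q ≡ b → q < suc l → bp 0 ≡ q
  first-b {q} vq q<1+l with proj₁ form q vq
  ... | zero  , bp≡q = bp≡q
  ... | suc j , refl = contradiction (≤-trans (m≤n+m (suc l) (bp j)) (bPos-step j)) (<⇒≱ q<1+l)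

  bPos-regular : ∀ {j K} → (∀ t → t < K → eps (j + t) ≡ fzero) →
    ∀ t → t ≤ K → bp (j + t) ≡ bp j + t * suc l
  bPos-regular {j} zeros zero    _   = trans (cong bp (+-identityʳ j)) (sym (+-identityʳ (bp j)))
  bPos-regular {j} zeros (suc t) t<K = begin
    bp (j + suc t)                              ≡⟨ cong bp (+-suc j t) ⟩
    bp (j + t) + suc (l + toℕ (eps (j + t)))    ≡⟨ cong (λ e → bp (j + t) + suc (l + toℕ e)) (zeros t t<K) ⟩
    bp (j + t) + suc (l + 0)                    ≡⟨ cong₂ (λ p n → p + suc n)
                                                     (bPos-regular zeros t (<⇒≤ t<K)) (+-identityʳ l) ⟩
    bp j + t * suc l + suc l                    ≡⟨ m+n*o+o≡m+[1+n]*o (bp j) t (suc l) ⟩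
    bp j + suc t * suc l                        ∎
    where open ≡-Reasoning

  chain-from-zeros : ∀ {j K} → (∀ t → t < K → eps (j + t) ≡ fzero) →
    ∀ t → t ≤ K → v (bp j + t * suc l) ≡ b
  chain-from-zeros {j} zeros t t≤K = subst (λ i → v i ≡ b) (bPos-regular zeros t t≤K) (proj₂ form (j + t))

  zeros-from-chain : ∀ {j K} → (∀ t → t ≤ K → v (bp j + t * suc l) ≡ b) →
    ∀ t → t < K → eps (j + t) ≡ fzero
  zeros-from-chain {j} {K} chain t t<K = zeros-below (suc t) t<K t ≤-refl
    where
    zeros-below : ∀ u → u ≤ K → ∀ t → t < u → eps (j + t) ≡ fzero
    zeros-below (suc u) u<K t t<1+u with m≤n⇒m<n∨m≡n (s≤s⁻¹ t<1+u)
    ... | inj₁ t<u  = zeros-below u (<⇒≤ u<K) t t<u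
    ... | inj₂ refl = consecutive-b⇒ε₀ (j + t) (subst (λ i → v i ≡ b) position (chain (suc t) u<K))
      where
      position : bp j + suc t * suc l ≡ bp (j + t) + suc l
      position = trans (sym (m+n*o+o≡m+[1+n]*o (bp j) t (suc l)))
                       (cong (_+ suc l) (sym (bPos-regular (zeros-below t (<⇒≤ u<K)) t ≤-refl)))

  module _ {k₀ : ℕ} (maxpow : ∀ i k → IsFactor v (pow (blk l (eps i)) k) → k ≤ k₀)
           (eps-sturmian : Sturmian eps) where

    no-chain-of-blocks : ∀ r → (∀ t → t ≤ k₀ → v (r + l + t * suc l) ≡ b) → ⊥
    no-chain-of-blocks r chain with sturmian-binary-letter eps-sturmian fzero
    ... | j , eps≡0 = 1+n≰n (maxpow j (suc k₀)
      (subst (λ e → IsFactor v (pow (blk l e) (suc k₀))) (sym eps≡0) (block-power b-spaced chain)))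

    -- Near the start the chain may begin inside a^{l₀} with l₀ < l; then it
    -- forces a prefix 0^{k₀} of ε, whose recurrence yields a chain further on.
    no-long-b-chain : ∀ q → (∀ t → t ≤ k₀ → v (q + t * suc l) ≡ b) → ⊥
    no-long-b-chain q chain with l ≤? q
    ... | yes l≤q = no-chain-of-blocks (q ∸ l)
      (subst (λ i → ∀ t → t ≤ k₀ → v (i + t * suc l) ≡ b) (sym (m∸n+n≡m l≤q)) chain)
    ... | no  l≰q = ¬¬-prefix-recurs _≟ᶠ_ eps-sturmian k₀ λ j recurs →
      no-chain-of-blocks (bp (suc j) ∸ l)
        (subst (λ i → ∀ t → t ≤ k₀ → v (i + t * suc l) ≡ b) (sym (m∸n+n≡m (l≤bPos j)))
          (chain-from-zeros (later-zeros j recurs)))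
      where
      l≤bPos : ∀ j → l ≤ bp (suc j)
      l≤bPos j = ≤-trans (n≤1+n l) (≤-trans (m≤n+m (suc l) (bp j)) (bPos-step j))
      starts-at-first-b : bp 0 ≡ q
      starts-at-first-b = first-b (trans (cong v (sym (+-identityʳ q))) (chain 0 z≤n)) (m<n⇒m<1+n (≰⇒> l≰q))
      prefix-zeros : ∀ t → t < k₀ → eps t ≡ fzero
      prefix-zeros = zeros-from-chain {0}
        (subst (λ i → ∀ t → t ≤ k₀ → v (i + t * suc l) ≡ b) (sym starts-at-first-b) chain)
      later-zeros : ∀ j → slice eps (suc j) k₀ ≡ slice eps 0 k₀ →
        ∀ t → t < k₀ → eps (suc j + t) ≡ fzero
      later-zeros j recurs t t<k₀ = trans (slice-≡⇒pointwise (suc j) 0 k₀ recurs t t<k₀) (prefix-zeros t t<k₀)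

    no-long-b-run : ∀ {i m} → k₀ * suc l < m → (∀ t → t < m → Finf l v (i + t) ≡ b) → ⊥
    no-long-b-run {i} {m} long all-b
      with Finf-b⇒b l v (subst (λ p → Finf l v p ≡ b) (+-identityʳ i) (all-b 0 (≤-<-trans z≤n long)))
    ... | s₀ , s₀<1+l , vb = no-long-b-chain (i + s₀) (b-chain b-spaced vb F-b)
      where
      F-b : ∀ t → t < k₀ → Finf l v (suc (i + s₀) + t * suc l) ≡ b
      F-b t t<k₀ = subst (λ p → Finf l v p ≡ b) position (all-b (suc s₀ + t * suc l) inside)
        where
        position : i + (suc s₀ + t * suc l) ≡ suc (i + s₀) + t * suc l
        position = trans (+-suc i (s₀ + t * suc l)) (cong suc (sym (+-assoc i s₀ (t * suc l))))
        inside : suc s₀ + t * suc l < m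
        inside = ≤-<-trans (≤-trans (+-monoˡ-≤ (t * suc l) s₀<1+l) (*-monoˡ-≤ (suc l) t<k₀)) long

    long-windows-determined : ∀ {i i′ m} → k₀ * suc l < m → slice (Finf l v) i m ≡ slice (Finf l v) i′ m →
      slice v i (m + l) ≡ slice v i′ (m + l)
    long-windows-determined {i} {i′} {m} long F-eq with a ∈? slice (Finf l v) i m
    ... | no  a∉ = ⊥-elim (no-long-b-run long λ t t<m →
      ≢a⇒≡b λ F-a → a∉ (subst (_∈ _) F-a (slice-∈ (Finf l v) i m t t<m)))
    ... | yes a∈ with ∈-slice⁻ i m a∈
    ...   | t₀ , t₀<m , F-a = begin
      slice v i (m + l)                   ≡⟨ unshift i ⟨
      slice (λ t → v (i + t)) 0 (m + l)   ≡⟨ slice-determined-by-Finf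
                                               (BSpaced-shift {x = v} b-spaced i) (BSpaced-shift {x = v} b-spaced i′)
                                               F-eq′ t₀<m (trans (Finf-shift l v i t₀) F-a) ⟩
      slice (λ t → v (i′ + t)) 0 (m + l)  ≡⟨ unshift i′ ⟩
      slice v i′ (m + l)                  ∎
      where
      open ≡-Reasoning
      unshift : ∀ k → slice (λ t → v (k + t)) 0 (m + l) ≡ slice v k (m + l)
      unshift k = trans (slice-shift v k 0 (m + l)) (cong (λ p → slice v p (m + l)) (+-identityʳ k))
      F-eq′ : ∀ t → t < m → Finf l (λ t → v (i + t)) t ≡ Finf l (λ t → v (i′ + t)) t
      F-eq′ t t<m = trans (Finf-shift l v i t)
        (trans (slice-≡⇒pointwise i i′ m F-eq t t<m) (sym (Finf-shift l v i′ t)))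

lemma5p4 : (v : InfWord Letter) → Sturmian v → IsFactor v (a ∷ a ∷ []) →
    (l0 l : ℕ) (eps : ℕ → Fin 2) → Sturmian eps → l0 ≤ suc l →
    HasForm v l0 l eps →
    (k0 : ℕ) → IsMaxPower v l eps k0 →
    (v1 : List Letter) → IsFactor (Finf l v) v1 → k0 * suc l < length v1 →
    ∃! _≡_ (λ u1 → IsFactor v u1 × length u1 ≡ length v1 + l × Fw l u1 ≡ v1)
lemma5p4 v _ _ _ l eps eps-sturmian _ form _ (_ , maxpow) v1 (i , v1-at-i) long =
  slice v i (m + l) , (slice-isFactor v i (m + l) , length-slice v i (m + l) , trans (Fw-slice l v i m) v1-at-i) , unique
  where
  m = length v1
  unique : ∀ {u} → IsFactor v u × length u ≡ m + l × Fw l u ≡ v1 → slice v i (m + l) ≡ u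
  unique (occurs , length-u , Fw-u) with factor-slice length-u occurs
  ... | i′ , refl = Form.long-windows-determined form maxpow eps-sturmian long
    (trans v1-at-i (trans (sym Fw-u) (Fw-slice l v i′ m)))
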